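{- A board $\mathfrak{S}$ has no isolated point if and only if $V(\mathfrak{S},\mathbb{Z})$ has maximal rank (namely rank $|\mathfrak{S}|$) in $\mathscr{F}(\mathfrak{S},\mathbb{Z})$.
   Context: A board $\mathfrak{S}$ is a finite subset of $\mathbb{Z}^2$. $\mathscr{F}(\mathfrak{S},\mathbb{Z})$ is the $\mathbb{Z}$-module of integer-valued functions on $\mathfrak{S}$; $[P]$ is the function equal to $1$ at $P$ and $0$ elsewhere. The set of moves $\mathscr{D}(\mathfrak{S})$ consists of all functions $[P]+[Q]-[R]$ with $P,Q,R\in\mathfrak{S}$, $Q=P+v$, $R=P+2v$ for some $v\in\{(\pm1,0),(0,\pm1)\}$; $Q$ is the middle point and $P,R$ the extremities. $V(\mathfrak{S},\mathbb{Z})$ is the $\mathbb{Z}$-span of $\mathscr{D}(\mathfrak{S})$. Two points are neighbors if they are the two extremities of some move; $\equiv$ is the reflexive-transitive closure of this relation. The board has no isolated point if every $P\in\mathfrak{S}$ is $\equiv$-equivalent to the middle point of some move. -}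

module Defs where

open import Data.Nat using (ℕ)
open import Data.Integer using (ℤ; _+_; _-_; _*_; +_; -_)
open import Data.Fin using (Fin; zero; suc; _≟_)
open import Data.Product using (_×_; _,_; ∃; ∃-syntax; Σ)
open import Data.Sum using (_⊎_)
open import Data.List using (List; []; _∷_)
open import Relation.Nullary using (yes; no)
open import Relation.Binary.PropositionalEquality using (_≡_)
open import Relation.Binary.Construct.Closure.ReflexiveTransitive using (Star)
open import Function.Definitions using (Injective)

Point : Set
Point = ℤ × ℤ

_⊕_ : Point → Point → Point
(a , b) ⊕ (c , d) = (a + c , b + d)

data Unit : Point → Set where
  e₁  : Unit (+ 1 , + 0)
  -e₁ : Unit (- + 1 , + 0)
  e₂  : Unit (+ 0 , + 1)
  -e₂ : Unit (+ 0 , - + 1)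

-- A board: a finite subset of ℤ², given as an injective enumeration of its
-- |𝔖| = n points by Fin n.
record Board : Set where
  field
    size : ℕ
    pos  : Fin size → Point
    pos-injective : Injective _≡_ _≡_ pos
open Board public

F : Board → Set
F S = Fin (size S) → ℤ

IsMove : (S : Board) → Fin (size S) → Fin (size S) → Fin (size S) → Set
IsMove S P Q R = ∃[ v ] (Unit v × (pos S Q ≡ pos S P ⊕ v) × (pos S R ≡ (pos S P ⊕ v) ⊕ v))

δ : ∀ {n} → Fin n → Fin n → ℤ
δ P X with P ≟ X
... | yes _ = + 1
... | no  _ = + 0

moveFun : (S : Board) → Fin (size S) → Fin (size S) → Fin (size S) → F S
moveFun S P Q R X = (δ P X + δ Q X) - δ R X

record Move (S : Board) : Set where
  constructor mkMove
  field
    P Q R  : Fin (size S)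
    isMove : IsMove S P Q R

combo : (S : Board) → List (ℤ × Move S) → F S
combo S [] X = + 0
combo S ((c , mkMove P Q R _) ∷ l) X = c * moveFun S P Q R X + combo S l X

InV : (S : Board) → F S → Set
InV S f = ∃[ l ] (∀ X → combo S l X ≡ f X)

sumFin : ∀ n → (Fin n → ℤ) → ℤ
sumFin ℕ.zero f = + 0
sumFin (ℕ.suc n) f = f zero + sumFin n (λ i → f (suc i))

LinIndep : (S : Board) (k : ℕ) → (Fin k → F S) → Set
LinIndep S k w = ∀ (c : Fin k → ℤ) →
  (∀ X → sumFin k (λ i → c i * w i X) ≡ + 0) → ∀ i → c i ≡ + 0

-- V(𝔖,ℤ) has maximal rank |𝔖|: it contains |𝔖| ℤ-linearly independent elements
-- (rank = maximal number of linearly independent elements; it is always ≤ |𝔖|).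
MaximalRank : Board → Set
MaximalRank S = Σ (Fin (size S) → F S) λ w →
  (∀ i → InV S (w i)) × LinIndep S (size S) w

Neighbors : (S : Board) → Fin (size S) → Fin (size S) → Set
Neighbors S A B = ∃[ Q ] (IsMove S A Q B ⊎ IsMove S B Q A)

Equiv : (S : Board) → Fin (size S) → Fin (size S) → Set
Equiv S = Star (Neighbors S)

NoIsolatedPoint : Board → Set
NoIsolatedPoint S = ∀ (X : Fin (size S)) →
  ∃[ P ] ∃[ Q ] ∃[ R ] (IsMove S P Q R × Equiv S X Q)

-- (⇒) For a move (P, Q, R) the move and its reverse add up to 2[Q], and for
-- neighbours A, B the function 2[A] - 2[B] is an integer combination of a
-- move and 2[Q]; so 2[X] ∈ V whenever X is equivalent to a middle point.
-- Without isolated points this gives the |𝔖| independent elements 2[X].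
-- (⇐) Let C be the equivalence class of X.  If C contains no middle point,
-- every move has either both extremities in C or none, and its middle point
-- outside C, so the indicator functional of C vanishes on all moves and
-- hence on V.  Since it is nonzero at X, V lies in a kernel of rank
-- |𝔖| - 1, contradicting maximal rank.
module Submission where

open import Defs
open import Data.Nat using (zero; suc)
open import Data.Integer using (ℤ; _+_; _-_; _*_; -_; 0ℤ; 1ℤ; -1ℤ)
open import Data.Integer.Tactic.RingSolver using (solve-∀)
import Data.Integer.Properties as ℤ
open import Data.Fin using (Fin; zero; suc; punchIn; punchOut; _≟_)
open import Data.Fin.Properties using (punchIn-punchOut; punchInᵢ≢i; any?; all?; ¬∀⟶∃¬)
open import Data.Fin.Subset using (Subset; _∈_; _∉_; _⊂_; _⊃_; _∪_; ⁅_⁆)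
open import Data.Fin.Subset.Properties using (_∈?_; p⊆p∪q; q⊆p∪q; x∈p∪q⁻; x∈⁅x⁆; x∈⁅y⁆⇒x≡y)
open import Data.Fin.Subset.Induction using (Acc; acc; ⊃-wellFounded)
open import Data.Product using (_×_; _,_; proj₁; proj₂; ∃-syntax; Σ-syntax)
open import Data.List using (List; []; _∷_; _++_; map)
open import Data.Sum using (_⊎_; inj₁; inj₂)
open import Data.Empty using (⊥-elim)
open import Function using (_∘_)
open import Relation.Nullary using (Dec; yes; no; ¬_; ¬?)
open import Relation.Nullary.Decidable using (_×-dec_; _⊎-dec_; map′)
open import Data.Product.Properties using (≡-dec)
open import Relation.Binary.PropositionalEquality using (_≡_; _≢_; refl; sym; trans; cong; cong₂; subst; module ≡-Reasoning)
open import Relation.Binary.Construct.Closure.ReflexiveTransitive using (Star; ε; _◅_; _◅◅_)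

open ≡-Reasoning

sum-cong : ∀ n {f g : Fin n → ℤ} → (∀ i → f i ≡ g i) → sumFin n f ≡ sumFin n g
sum-cong zero    f≡g = refl
sum-cong (suc n) f≡g = cong₂ _+_ (f≡g zero) (sum-cong n (f≡g ∘ suc))

sum-zero : ∀ n {f : Fin n → ℤ} → (∀ i → f i ≡ 0ℤ) → sumFin n f ≡ 0ℤ
sum-zero zero    f≡0 = refl
sum-zero (suc n) f≡0 = cong₂ _+_ (f≡0 zero) (sum-zero n (f≡0 ∘ suc))

sum-+ : ∀ n (f g : Fin n → ℤ) → sumFin n (λ i → f i + g i) ≡ sumFin n f + sumFin n g
sum-+ zero    f g = refl
sum-+ (suc n) f g = begin
  (f zero + g zero) + sumFin n (λ i → f (suc i) + g (suc i))
    ≡⟨ cong ((f zero + g zero) +_) (sum-+ n (f ∘ suc) (g ∘ suc)) ⟩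
  (f zero + g zero) + (sumFin n (f ∘ suc) + sumFin n (g ∘ suc))
    ≡⟨ interchange (f zero) (g zero) _ _ ⟩
  (f zero + sumFin n (f ∘ suc)) + (g zero + sumFin n (g ∘ suc)) ∎
  where
  interchange : ∀ a b c d → (a + b) + (c + d) ≡ (a + c) + (b + d)
  interchange = solve-∀

sum-* : ∀ n a (f : Fin n → ℤ) → sumFin n (λ i → a * f i) ≡ a * sumFin n f
sum-* zero    a f = sym (ℤ.*-zeroʳ a)
sum-* (suc n) a f = trans (cong (a * f zero +_) (sum-* n a (f ∘ suc)))
                          (sym (ℤ.*-distribˡ-+ a (f zero) _))

sum-swap : ∀ n m (f : Fin n → Fin m → ℤ) →
  sumFin n (λ i → sumFin m (f i)) ≡ sumFin m (λ j → sumFin n (λ i → f i j))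
sum-swap zero    m f = sym (sum-zero m (λ _ → refl))
sum-swap (suc n) m f = trans (cong (sumFin m (f zero) +_) (sum-swap n m (f ∘ suc)))
                             (sym (sum-+ m (f zero) (λ j → sumFin n (λ i → f (suc i) j))))

sum-single : ∀ n (X : Fin (suc n)) (f : Fin (suc n) → ℤ) →
  (∀ x → f (punchIn X x) ≡ 0ℤ) → sumFin (suc n) f ≡ f X
sum-single n       zero    f f-off = trans (cong (f zero +_) (sum-zero n f-off)) (ℤ.+-identityʳ (f zero))
sum-single (suc n) (suc X) f f-off =
  trans (cong₂ _+_ (f-off zero) (sum-single n X (f ∘ suc) (f-off ∘ suc))) (ℤ.+-identityˡ (f (suc X)))

lincomb : ∀ {m k} → (Fin m → ℤ) → (Fin m → Fin k → ℤ) → Fin k → ℤ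
lincomb {m} c v y = sumFin m (λ i → c i * v i y)

⟨_,_⟩ : ∀ {k} → (Fin k → ℤ) → (Fin k → ℤ) → ℤ
⟨_,_⟩ {k} ι f = sumFin k (λ y → ι y * f y)

pairing-+ : ∀ {k} (ι f g : Fin k → ℤ) → ⟨ ι , (λ y → f y + g y) ⟩ ≡ ⟨ ι , f ⟩ + ⟨ ι , g ⟩
pairing-+ {k} ι f g = trans (sum-cong k (λ y → ℤ.*-distribˡ-+ (ι y) (f y) (g y)))
                            (sum-+ k (λ y → ι y * f y) (λ y → ι y * g y))

pairing-* : ∀ {k} (ι : Fin k → ℤ) a (f : Fin k → ℤ) → ⟨ ι , (λ y → a * f y) ⟩ ≡ a * ⟨ ι , f ⟩
pairing-* {k} ι a f = trans (sum-cong k (λ y → commute (ι y) a (f y))) (sum-* k a (λ y → ι y * f y))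
  where
  commute : ∀ i a b → i * (a * b) ≡ a * (i * b)
  commute = solve-∀

pairing-neg : ∀ {k} (ι f : Fin k → ℤ) → ⟨ ι , (λ y → - f y) ⟩ ≡ - ⟨ ι , f ⟩
pairing-neg {k} ι f = begin
  ⟨ ι , (λ y → - f y) ⟩       ≡⟨ sum-cong k (λ y → cong (ι y *_) (sym (ℤ.-1*i≡-i (f y)))) ⟩
  ⟨ ι , (λ y → -1ℤ * f y) ⟩   ≡⟨ pairing-* ι -1ℤ f ⟩
  -1ℤ * ⟨ ι , f ⟩             ≡⟨ ℤ.-1*i≡-i _ ⟩
  - ⟨ ι , f ⟩                 ∎

pairing-lincomb : ∀ {m k} (ι : Fin k → ℤ) (c : Fin m → ℤ) (v : Fin m → Fin k → ℤ) →
  ⟨ ι , lincomb c v ⟩ ≡ sumFin m (λ i → c i * ⟨ ι , v i ⟩)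
pairing-lincomb {m} {k} ι c v = begin
  sumFin k (λ y → ι y * sumFin m (λ i → c i * v i y))
    ≡⟨ sum-cong k (λ y → sym (sum-* m (ι y) (λ i → c i * v i y))) ⟩
  sumFin k (λ y → sumFin m (λ i → ι y * (c i * v i y)))
    ≡⟨ sum-swap k m (λ y i → ι y * (c i * v i y)) ⟩
  sumFin m (λ i → ⟨ ι , (λ y → c i * v i y) ⟩)
    ≡⟨ sum-cong m (λ i → pairing-* ι (c i) (v i)) ⟩
  sumFin m (λ i → c i * ⟨ ι , v i ⟩) ∎

nonzero-* : ∀ {a b} → a ≢ 0ℤ → b ≢ 0ℤ → a * b ≢ 0ℤ
nonzero-* {a} a≢0 b≢0 ab≡0 with ℤ.i*j≡0⇒i≡0∨j≡0 a ab≡0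
... | inj₁ a≡0 = a≢0 a≡0
... | inj₂ b≡0 = b≢0 b≡0

vanishing : ∀ {k} (g : Fin (suc k) → ℤ) p → g p ≡ 0ℤ → (∀ x → g (punchIn p x) ≡ 0ℤ) →
  ∀ y → g y ≡ 0ℤ
vanishing g p gp≡0 g-off y with p ≟ y
... | yes refl = gp≡0
... | no  p≢y  = subst (λ z → g z ≡ 0ℤ) (punchIn-punchOut p≢y) (g-off (punchOut p≢y))

record Dependence {m k} (v : Fin m → Fin k → ℤ) : Set where
  field
    coeff         : Fin m → ℤ
    index         : Fin m
    coeff-nonzero : coeff index ≢ 0ℤ
    relation      : ∀ y → lincomb coeff v y ≡ 0ℤ

-- If the first of k+2 vectors of ℤᵏ⁺¹ has a
-- nonzero entry a at p, clear coordinate p of the others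
-- (wⱼ = a·vⱼ₊₁ - vⱼ₊₁(p)·v₀); a dependence among the wⱼ restricted to the
-- remaining k coordinates yields a dependence among the vᵢ.
eliminate : ∀ k (v : Fin (suc (suc k)) → Fin (suc k) → ℤ) p → v zero p ≢ 0ℤ →
  (∀ (u : Fin (suc k) → Fin k → ℤ) → Dependence u) → Dependence v
eliminate k v p a≢0 dependent-k = record
  { coeff = c ; index = suc j ; coeff-nonzero = nonzero-* a≢0 d≢0 ; relation = c-relation }
  where
  a = v zero p

  cleared : Fin (suc k) → Fin (suc k) → ℤ
  cleared j y = a * v (suc j) y - v (suc j) p * v zero y

  open Dependence (dependent-k (λ j x → cleared j (punchIn p x)))
    renaming (coeff to d; index to j; coeff-nonzero to d≢0; relation to d-relation)

  T : Fin (suc k) → ℤ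
  T = lincomb d (v ∘ suc)

  c : Fin (suc (suc k)) → ℤ
  c zero    = - T p
  c (suc j) = a * d j

  cleared-p : lincomb d cleared p ≡ 0ℤ
  cleared-p = sum-zero (suc k) (λ j → cancel (d j) a (v (suc j) p))
    where
    cancel : ∀ d a b → d * (a * b - b * a) ≡ 0ℤ
    cancel = solve-∀

  c-cleared : ∀ y → lincomb c v y ≡ lincomb d cleared y
  c-cleared y = begin
    - T p * v zero y + sumFin (suc k) (λ j → a * d j * v (suc j) y)
      ≡⟨ cong (- T p * v zero y +_) (trans (sum-cong (suc k) (λ j → ℤ.*-assoc a (d j) (v (suc j) y)))
                                             (sum-* (suc k) a (λ j → d j * v (suc j) y))) ⟩
    - T p * v zero y + a * T y
      ≡⟨ reorder (T p) (v zero y) a (T y) ⟩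
    a * T y + (- v zero y) * T p
      ≡⟨ sym (cong₂ _+_ (sum-* (suc k) a (λ j → d j * v (suc j) y))
                        (sum-* (suc k) (- v zero y) (λ j → d j * v (suc j) p))) ⟩
    sumFin (suc k) (λ j → a * (d j * v (suc j) y)) + sumFin (suc k) (λ j → - v zero y * (d j * v (suc j) p))
      ≡⟨ sym (sum-+ (suc k) (λ j → a * (d j * v (suc j) y)) (λ j → - v zero y * (d j * v (suc j) p))) ⟩
    sumFin (suc k) (λ j → a * (d j * v (suc j) y) + - v zero y * (d j * v (suc j) p))
      ≡⟨ sum-cong (suc k) (λ j → factor a (d j) (v (suc j) y) (v zero y) (v (suc j) p)) ⟩
    lincomb d cleared y ∎
    where
    reorder : ∀ s w a t → - s * w + a * t ≡ a * t + (- w) * s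
    reorder = solve-∀
    factor : ∀ a d x w z → a * (d * x) + (- w) * (d * z) ≡ d * (a * x - z * w)
    factor = solve-∀

  c-relation : ∀ y → lincomb c v y ≡ 0ℤ
  c-relation y = trans (c-cleared y) (vanishing (lincomb d cleared) p cleared-p d-relation y)

dependent : ∀ k (v : Fin (suc k) → Fin k → ℤ) → Dependence v
dependent zero    v = record { coeff = λ _ → 1ℤ ; index = zero ; coeff-nonzero = λ () ; relation = λ () }
dependent (suc k) v with all? (λ p → v zero p ℤ.≟ 0ℤ)
... | no  v₀≢0 = let (p , a≢0) = ¬∀⟶∃¬ (suc k) _ (λ p → v zero p ℤ.≟ 0ℤ) v₀≢0
                 in eliminate k v p a≢0 (dependent k)
... | yes v₀≡0 = record { coeff = first ; index = zero ; coeff-nonzero = λ () ; relation = first-relation }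
  where
  first : Fin (suc (suc k)) → ℤ
  first zero    = 1ℤ
  first (suc _) = 0ℤ
  first-relation : ∀ y → lincomb first v y ≡ 0ℤ
  first-relation y = cong₂ _+_ (trans (ℤ.*-identityˡ (v zero y)) (v₀≡0 y))
                               (sum-zero (suc k) (λ i → ℤ.*-zeroˡ (v (suc i) y)))

-- The kernel of a nonzero functional on ℤⁿ has rank n - 1, so it contains
-- no n linearly independent vectors.
kernel-not-independent : ∀ n (w : Fin n → Fin n → ℤ) (ι : Fin n → ℤ) X → ι X ≢ 0ℤ →
  (∀ i → ⟨ ι , w i ⟩ ≡ 0ℤ) →
  ¬ (∀ (c : Fin n → ℤ) → (∀ y → lincomb c w y ≡ 0ℤ) → ∀ i → c i ≡ 0ℤ)
kernel-not-independent (suc k) w ι X ιX≢0 w-kernel independent = c≢0 (independent c g≡0 j)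
  where
  open Dependence (dependent k (λ i x → w i (punchIn X x)))
    renaming (coeff to c; index to j; coeff-nonzero to c≢0; relation to g-off)

  g : Fin (suc k) → ℤ
  g = lincomb c w

  g-kernel : ⟨ ι , g ⟩ ≡ 0ℤ
  g-kernel = trans (pairing-lincomb ι c w)
                   (sum-zero (suc k) (λ i → trans (cong (c i *_) (w-kernel i)) (ℤ.*-zeroʳ (c i))))

  ιX*gX≡0 : ι X * g X ≡ 0ℤ
  ιX*gX≡0 = trans (sym (sum-single k X (λ y → ι y * g y)
                          (λ x → trans (cong (ι (punchIn X x) *_) (g-off x)) (ℤ.*-zeroʳ (ι (punchIn X x))))))
                  g-kernel

  gX≡0 : g X ≡ 0ℤ
  gX≡0 with ℤ.i*j≡0⇒i≡0∨j≡0 (ι X) ιX*gX≡0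
  ... | inj₁ ιX≡0 = ⊥-elim (ιX≢0 ιX≡0)
  ... | inj₂ gX≡0 = gX≡0

  g≡0 : ∀ y → g y ≡ 0ℤ
  g≡0 = vanishing g X gX≡0 g-off

-- For a decidable relation N on
-- Fin n we compute a subset containing X, closed under N-steps, all of whose
-- elements are reachable from X; it grows one vertex at a time, which
-- terminates since _⊃_ is well founded on subsets of Fin n.
module Component {n} (N : Fin n → Fin n → Set) (N? : ∀ a b → Dec (N a b)) (X : Fin n) where

  Closed : Subset n → Set
  Closed C = ∀ {Z Y} → Z ∈ C → N Z Y → Y ∈ C

  Reachable : Subset n → Set
  Reachable C = ∀ {Y} → Y ∈ C → Star N X Y

  Exit : Subset n → Set
  Exit C = ∃[ Z ] ∃[ Y ] (Z ∈ C × Y ∉ C × N Z Y)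

  exit? : ∀ C → Dec (Exit C)
  exit? C = any? (λ Z → any? (λ Y → Z ∈? C ×-dec ¬? (Y ∈? C) ×-dec N? Z Y))

  no-exit⇒closed : ∀ {C} → ¬ Exit C → Closed C
  no-exit⇒closed {C} no-exit {Z} {Y} Z∈C ZY with Y ∈? C
  ... | yes Y∈C = Y∈C
  ... | no  Y∉C = ⊥-elim (no-exit (Z , Y , Z∈C , Y∉C , ZY))

  grow : ∀ C → Acc _⊃_ C → X ∈ C → Reachable C → Σ[ D ∈ Subset n ] (X ∈ D × Reachable D × Closed D)
  grow C (acc smaller) X∈C reach with exit? C
  ... | no  no-exit = C , X∈C , reach , no-exit⇒closed no-exit
  ... | yes (Z , Y , Z∈C , Y∉C , ZY) =
    grow (C ∪ ⁅ Y ⁆) (smaller C⊂C∪Y) (p⊆p∪q ⁅ Y ⁆ X∈C) reach′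
    where
    C⊂C∪Y : C ⊂ C ∪ ⁅ Y ⁆
    C⊂C∪Y = p⊆p∪q ⁅ Y ⁆ , Y , q⊆p∪q C ⁅ Y ⁆ (x∈⁅x⁆ Y) , Y∉C
    reach′ : Reachable (C ∪ ⁅ Y ⁆)
    reach′ W∈ with x∈p∪q⁻ C ⁅ Y ⁆ W∈
    ... | inj₁ W∈C = reach W∈C
    ... | inj₂ W∈Y rewrite x∈⁅y⁆⇒x≡y Y W∈Y = reach Z∈C ◅◅ (ZY ◅ ε)

  component : Σ[ C ∈ Subset n ] (X ∈ C × Reachable C × Closed C)
  component = grow ⁅ X ⁆ (⊃-wellFounded ⁅ X ⁆) (x∈⁅x⁆ X) singleton-reachable
    where
    singleton-reachable : Reachable ⁅ X ⁆
    singleton-reachable Y∈ rewrite x∈⁅y⁆⇒x≡y X Y∈ = ε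

indicator : ∀ {n} → Subset n → Fin n → ℤ
indicator C Y with Y ∈? C
... | yes _ = 1ℤ
... | no  _ = 0ℤ

indicator-in : ∀ {n} {C : Subset n} {Y} → Y ∈ C → indicator C Y ≡ 1ℤ
indicator-in {C = C} {Y} Y∈C with Y ∈? C
... | yes _   = refl
... | no  Y∉C = ⊥-elim (Y∉C Y∈C)

indicator-out : ∀ {n} {C : Subset n} {Y} → Y ∉ C → indicator C Y ≡ 0ℤ
indicator-out {C = C} {Y} Y∉C with Y ∈? C
... | yes Y∈C = ⊥-elim (Y∉C Y∈C)
... | no  _   = refl

δ-self : ∀ {n} (P : Fin n) → δ P P ≡ 1ℤ
δ-self P with P ≟ P
... | yes _   = refl
... | no  P≢P = ⊥-elim (P≢P refl)

δ-other : ∀ {n} {P X : Fin n} → P ≢ X → δ P X ≡ 0ℤ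
δ-other {P = P} {X} P≢X with P ≟ X
... | yes P≡X = ⊥-elim (P≢X P≡X)
... | no  _   = refl

pairing-δ : ∀ {n} (ι : Fin n → ℤ) P → ⟨ ι , δ P ⟩ ≡ ι P
pairing-δ {suc k} ι P = begin
  ⟨ ι , δ P ⟩    ≡⟨ sum-single k P (λ Y → ι Y * δ P Y)
                      (λ x → trans (cong (ι (punchIn P x) *_) (δ-other (punchInᵢ≢i P x ∘ sym)))
                                   (ℤ.*-zeroʳ (ι (punchIn P x)))) ⟩
  ι P * δ P P    ≡⟨ cong (ι P *_) (δ-self P) ⟩
  ι P * 1ℤ       ≡⟨ ℤ.*-identityʳ (ι P) ⟩
  ι P            ∎

lincomb-δ : ∀ {n} (c : Fin n → ℤ) X → lincomb c δ X ≡ c X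
lincomb-δ {suc k} c X = begin
  lincomb c δ X   ≡⟨ sum-single k X (λ i → c i * δ i X)
                       (λ x → trans (cong (c (punchIn X x) *_) (δ-other (punchInᵢ≢i X x)))
                                    (ℤ.*-zeroʳ (c (punchIn X x)))) ⟩
  c X * δ X X     ≡⟨ cong (c X *_) (δ-self X) ⟩
  c X * 1ℤ        ≡⟨ ℤ.*-identityʳ (c X) ⟩
  c X             ∎

pairing-move : ∀ (S : Board) (ι : F S) P Q R → ⟨ ι , moveFun S P Q R ⟩ ≡ ι P + ι Q - ι R
pairing-move S ι P Q R = begin
  ⟨ ι , moveFun S P Q R ⟩
    ≡⟨ pairing-+ ι (λ X → δ P X + δ Q X) (λ X → - δ R X) ⟩
  ⟨ ι , (λ X → δ P X + δ Q X) ⟩ + ⟨ ι , (λ X → - δ R X) ⟩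
    ≡⟨ cong₂ _+_ (pairing-+ ι (δ P) (δ Q)) (pairing-neg ι (δ R)) ⟩
  (⟨ ι , δ P ⟩ + ⟨ ι , δ Q ⟩) - ⟨ ι , δ R ⟩
    ≡⟨ cong₂ _-_ (cong₂ _+_ (pairing-δ ι P) (pairing-δ ι Q)) (pairing-δ ι R) ⟩
  ι P + ι Q - ι R ∎

2ℤ : ℤ
2ℤ = 1ℤ + 1ℤ

module _ (S : Board) where

  private
    n = size S

  opposite : ∀ {x y} → Unit (x , y) → Unit (- x , - y)
  opposite e₁  = -e₁
  opposite -e₁ = e₁
  opposite e₂  = -e₂
  opposite -e₂ = e₂

  reverse : ∀ {P Q R} → IsMove S P Q R → IsMove S R Q P
  reverse {P} {Q} {R} ((x , y) , u , Q≡ , R≡) = (- x , - y) , opposite u , Q≡′ , P≡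
    where
    back₁ : ∀ a v → a + v ≡ ((a + v) + v) + - v
    back₁ = solve-∀
    back₂ : ∀ a v → a ≡ (((a + v) + v) + - v) + - v
    back₂ = solve-∀
    p = pos S P
    Q≡′ : pos S Q ≡ pos S R ⊕ (- x , - y)
    Q≡′ = trans Q≡ (trans (cong₂ _,_ (back₁ (proj₁ p) x) (back₁ (proj₂ p) y))
                          (cong (_⊕ (- x , - y)) (sym R≡)))
    P≡ : pos S P ≡ (pos S R ⊕ (- x , - y)) ⊕ (- x , - y)
    P≡ = trans (cong₂ _,_ (back₂ (proj₁ p) x) (back₂ (proj₂ p) y))
               (cong (λ z → (z ⊕ (- x , - y)) ⊕ (- x , - y)) (sym R≡))

  -- Deciding the board relations: a move has one of four directions.

  Along : Point → Fin n → Fin n → Fin n → Set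
  Along v P Q R = (pos S Q ≡ pos S P ⊕ v) × (pos S R ≡ (pos S P ⊕ v) ⊕ v)

  along? : ∀ v P Q R → Dec (Along v P Q R)
  along? v P Q R = (pos S Q ≟ᴾ (pos S P ⊕ v)) ×-dec (pos S R ≟ᴾ ((pos S P ⊕ v) ⊕ v))
    where
    _≟ᴾ_ : (a b : Point) → Dec (a ≡ b)
    _≟ᴾ_ = ≡-dec ℤ._≟_ ℤ._≟_

  AlongSomeUnit : Fin n → Fin n → Fin n → Set
  AlongSomeUnit P Q R = Along (1ℤ , 0ℤ) P Q R ⊎ Along (-1ℤ , 0ℤ) P Q R ⊎
                        Along (0ℤ , 1ℤ) P Q R ⊎ Along (0ℤ , -1ℤ) P Q R

  isMove? : ∀ P Q R → Dec (IsMove S P Q R)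
  isMove? P Q R = map′ toMove fromMove
    (along? (1ℤ , 0ℤ) P Q R ⊎-dec along? (-1ℤ , 0ℤ) P Q R ⊎-dec
     along? (0ℤ , 1ℤ) P Q R ⊎-dec along? (0ℤ , -1ℤ) P Q R)
    where
    toMove : AlongSomeUnit P Q R → IsMove S P Q R
    toMove (inj₁ a)               = _ , e₁ , a
    toMove (inj₂ (inj₁ a))        = _ , -e₁ , a
    toMove (inj₂ (inj₂ (inj₁ a))) = _ , e₂ , a
    toMove (inj₂ (inj₂ (inj₂ a))) = _ , -e₂ , a
    fromMove : IsMove S P Q R → AlongSomeUnit P Q R
    fromMove (_ , e₁ , a)  = inj₁ a
    fromMove (_ , -e₁ , a) = inj₂ (inj₁ a)
    fromMove (_ , e₂ , a)  = inj₂ (inj₂ (inj₁ a))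
    fromMove (_ , -e₂ , a) = inj₂ (inj₂ (inj₂ a))

  neighbors? : ∀ A B → Dec (Neighbors S A B)
  neighbors? A B = any? (λ Q → isMove? A Q B ⊎-dec isMove? B Q A)

  Middle : Fin n → Set
  Middle Q = ∃[ P ] ∃[ R ] IsMove S P Q R

  middle? : ∀ Q → Dec (Middle Q)
  middle? Q = any? (λ P → any? (λ R → isMove? P Q R))

  combo-++ : ∀ l₁ l₂ X → combo S (l₁ ++ l₂) X ≡ combo S l₁ X + combo S l₂ X
  combo-++ []                               l₂ X = sym (ℤ.+-identityˡ (combo S l₂ X))
  combo-++ ((c , mkMove P Q R _) ∷ l₁) l₂ X =
    trans (cong (c * moveFun S P Q R X +_) (combo-++ l₁ l₂ X))
          (sym (ℤ.+-assoc (c * moveFun S P Q R X) (combo S l₁ X) (combo S l₂ X)))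

  scale : ℤ → List (ℤ × Move S) → List (ℤ × Move S)
  scale a = map (λ (c , m) → (a * c , m))

  combo-scale : ∀ a l X → combo S (scale a l) X ≡ a * combo S l X
  combo-scale a []                          X = sym (ℤ.*-zeroʳ a)
  combo-scale a ((c , mkMove P Q R _) ∷ l) X =
    trans (cong ((a * c) * moveFun S P Q R X +_) (combo-scale a l X))
          (distribute a c (moveFun S P Q R X) (combo S l X))
    where
    distribute : ∀ a c m r → (a * c) * m + a * r ≡ a * (c * m + r)
    distribute = solve-∀

  InV-ext : ∀ {f g : F S} → (∀ X → f X ≡ g X) → InV S f → InV S g
  InV-ext f≡g (l , l≡f) = l , (λ X → trans (l≡f X) (f≡g X))

  InV-+ : ∀ {f g : F S} → InV S f → InV S g → InV S (λ X → f X + g X)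
  InV-+ (l₁ , l₁≡f) (l₂ , l₂≡g) =
    l₁ ++ l₂ , (λ X → trans (combo-++ l₁ l₂ X) (cong₂ _+_ (l₁≡f X) (l₂≡g X)))

  InV-* : ∀ a {f : F S} → InV S f → InV S (λ X → a * f X)
  InV-* a (l , l≡f) = scale a l , (λ X → trans (combo-scale a l X) (cong (a *_) (l≡f X)))

  move-InV : ∀ {P Q R} → IsMove S P Q R → InV S (moveFun S P Q R)
  move-InV {P} {Q} {R} m =
    (1ℤ , mkMove P Q R m) ∷ [] , (λ X → trans (ℤ.+-identityʳ _) (ℤ.*-identityˡ (moveFun S P Q R X)))

  twiceδ : Fin n → F S
  twiceδ Q X = 2ℤ * δ Q X

  -- 2[Q] = ([P] + [Q] - [R]) + ([R] + [Q] - [P]) for a move with middle Q.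
  middle-InV : ∀ {P Q R} → IsMove S P Q R → InV S (twiceδ Q)
  middle-InV {P} {Q} {R} m =
    InV-ext (λ X → sum-of-reverses (δ P X) (δ Q X) (δ R X)) (InV-+ (move-InV m) (move-InV (reverse m)))
    where
    sum-of-reverses : ∀ p q r → ((p + q) - r) + ((r + q) - p) ≡ 2ℤ * q
    sum-of-reverses = solve-∀

  -- 2[A] = 2([A] + [Q] - [B]) - 2[Q] + 2[B] for a move from A over Q to B.
  neighbor-InV : ∀ {A B} → Neighbors S A B → InV S (twiceδ B) → InV S (twiceδ A)
  neighbor-InV {A} {B} (Q , inj₂ m) = neighbor-InV (Q , inj₁ (reverse m))
  neighbor-InV {A} {B} (Q , inj₁ m) 2[B]∈V =
    InV-ext (λ X → jump (δ A X) (δ Q X) (δ B X))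
      (InV-+ (InV-+ (InV-* 2ℤ (move-InV m)) (InV-* -1ℤ (middle-InV m))) 2[B]∈V)
    where
    jump : ∀ a q b → (2ℤ * ((a + q) - b) + -1ℤ * (2ℤ * q)) + 2ℤ * b ≡ 2ℤ * a
    jump = solve-∀

  equiv-InV : ∀ {X Q} → Equiv S X Q → InV S (twiceδ Q) → InV S (twiceδ X)
  equiv-InV ε              2[Q]∈V = 2[Q]∈V
  equiv-InV (step ◅ steps) 2[Q]∈V = neighbor-InV step (equiv-InV steps 2[Q]∈V)

  -- The 2[X] are independent: Σᵢ cᵢ·2[i] takes the value 2cₓ at X.
  twiceδ-independent : LinIndep S n twiceδ
  twiceδ-independent c relation X with ℤ.i*j≡0⇒i≡0∨j≡0 2ℤ (trans (sym (value-at X)) (relation X))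
    where
    value-at : ∀ X → lincomb c twiceδ X ≡ 2ℤ * c X
    value-at X = begin
      sumFin n (λ i → c i * (2ℤ * δ i X))   ≡⟨ sum-cong n (λ i → commute (c i) 2ℤ (δ i X)) ⟩
      sumFin n (λ i → 2ℤ * (c i * δ i X))   ≡⟨ sum-* n 2ℤ (λ i → c i * δ i X) ⟩
      2ℤ * lincomb c δ X                     ≡⟨ cong (2ℤ *_) (lincomb-δ c X) ⟩
      2ℤ * c X                               ∎
      where
      commute : ∀ c a d → c * (a * d) ≡ a * (c * d)
      commute = solve-∀
  ... | inj₁ ()
  ... | inj₂ cX≡0 = cX≡0

  no-isolated⇒maximal-rank : NoIsolatedPoint S → MaximalRank S
  no-isolated⇒maximal-rank no-isolated = twiceδ , twiceδ-InV , twiceδ-independent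
    where
    twiceδ-InV : ∀ X → InV S (twiceδ X)
    twiceδ-InV X = let (P , Q , R , m , X≡Q) = no-isolated X in equiv-InV X≡Q (middle-InV m)

  annihilates-V : (ι : F S) → (∀ {P Q R} → IsMove S P Q R → ⟨ ι , moveFun S P Q R ⟩ ≡ 0ℤ) →
    ∀ {f} → InV S f → ⟨ ι , f ⟩ ≡ 0ℤ
  annihilates-V ι kills-moves (l , l≡f) =
    trans (sum-cong n (λ X → cong (ι X *_) (sym (l≡f X)))) (kills-combo l)
    where
    kills-combo : ∀ l → ⟨ ι , combo S l ⟩ ≡ 0ℤ
    kills-combo []                          = sum-zero n (λ X → ℤ.*-zeroʳ (ι X))
    kills-combo ((c , mkMove P Q R m) ∷ l) = begin
      ⟨ ι , (λ X → c * moveFun S P Q R X + combo S l X) ⟩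
        ≡⟨ pairing-+ ι (λ X → c * moveFun S P Q R X) (combo S l) ⟩
      ⟨ ι , (λ X → c * moveFun S P Q R X) ⟩ + ⟨ ι , combo S l ⟩
        ≡⟨ cong₂ _+_ (pairing-* ι c (moveFun S P Q R)) (kills-combo l) ⟩
      c * ⟨ ι , moveFun S P Q R ⟩ + 0ℤ
        ≡⟨ cong (λ z → c * z + 0ℤ) (kills-moves m) ⟩
      c * 0ℤ + 0ℤ
        ≡⟨ cong (_+ 0ℤ) (ℤ.*-zeroʳ c) ⟩
      0ℤ ∎

  -- If C is closed under neighbours and contains no middle point, then for a
  -- move (P, Q, R) both extremities or neither lie in C, and Q does not.
  indicator-annihilates-moves : ∀ {C} → (∀ {Z Y} → Z ∈ C → Neighbors S Z Y → Y ∈ C) →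
    (∀ {Q} → Q ∈ C → ¬ Middle Q) →
    ∀ {P Q R} → IsMove S P Q R → ⟨ indicator C , moveFun S P Q R ⟩ ≡ 0ℤ
  indicator-annihilates-moves {C} closed no-middle {P} {Q} {R} m
    rewrite pairing-move S (indicator C) P Q R
          | indicator-out {C = C} (λ Q∈C → no-middle Q∈C (P , R , m))
    with P ∈? C | R ∈? C
  ... | yes _   | yes _   = refl
  ... | no  _   | no  _   = refl
  ... | yes P∈C | no  R∉C = ⊥-elim (R∉C (closed P∈C (Q , inj₁ m)))
  ... | no  P∉C | yes R∈C = ⊥-elim (P∉C (closed R∈C (Q , inj₂ m)))

  maximal-rank⇒no-isolated : MaximalRank S → NoIsolatedPoint S
  maximal-rank⇒no-isolated (w , w∈V , independent) X
    with Component.component (Neighbors S) neighbors? X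
  ... | C , X∈C , reachable , closed with any? (λ Y → Y ∈? C ×-dec middle? Y)
  ...   | yes (Q , Q∈C , P , R , m) = P , Q , R , m , reachable Q∈C
  ...   | no  no-middle =
    ⊥-elim (kernel-not-independent n w (indicator C) X ιX≢0 C-annihilates-w independent)
    where
    ιX≢0 : indicator C X ≢ 0ℤ
    ιX≢0 ιX≡0 with () ← trans (sym (indicator-in X∈C)) ιX≡0
    C-annihilates-w : ∀ i → ⟨ indicator C , w i ⟩ ≡ 0ℤ
    C-annihilates-w i = annihilates-V (indicator C)
      (indicator-annihilates-moves closed (λ Q∈C middle → no-middle (_ , Q∈C , middle)))
      (w∈V i)

theorem3 : (S : Board) → (NoIsolatedPoint S → MaximalRank S) × (MaximalRank S → NoIsolatedPoint S)
theorem3 S = no-isolated⇒maximal-rank S , maximal-rank⇒no-isolated S
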